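{- Let $b$ be a positive integer. Then $t(3,5,4b;4n+3)=t(3,5,b;n)$ for every positive integer $n$, and for $|q|<1$, $$\sum_{n=0}^{\infty}t(3,5,4b;4n+5)q^n=8\psi(q^b)\big(\varphi(q^{10})\psi(q^{12})+q\varphi(q^6)\psi(q^{20})\big).$$
   Context: For positive integers $a,b,c$ and $n\in\mathbb{N}=\{0,1,2,\dots\}$, $t(a,b,c;n)$ denotes the number of triples $(x,y,z)\in\mathbb{Z}^3$ with $n=a\frac{x(x+1)}2+b\frac{y(y+1)}2+c\frac{z(z+1)}2$. Ramanujan's theta functions are $\varphi(q)=\sum_{n=-\infty}^{\infty}q^{n^2}$ and $\psi(q)=\sum_{n=0}^{\infty}q^{n(n+1)/2}$ for $|q|<1$. -}

module Defs where

open import Data.Nat as ℕ using (ℕ; zero; suc)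
open import Data.Integer as ℤ using (ℤ; +_; -[1+_])
open import Data.List using (List; []; _∷_; map; concatMap; length; filter; upTo)
open import Data.Nat.ListAction using (sum)
open import Data.Product using (_×_; _,_)
open import Relation.Binary.PropositionalEquality using (_≡_)

intRange : ℕ → List ℤ
intRange m = map -[1+_] (upTo (suc m)) Data.List.++ map +_ (upTo (suc m))

triples : ℕ → List (ℤ × ℤ × ℤ)
triples m = concatMap (λ x → concatMap (λ y → map (λ z → x , y , z) (intRange m)) (intRange m)) (intRange m)

-- twice the generalized triangular number: 2 * (x(x+1)/2) = x(x+1)
twoTri : ℤ → ℤ
twoTri x = x ℤ.* (x ℤ.+ + 1)

-- t(a,b,c;n) = #{(x,y,z) ∈ ℤ³ : n = a x(x+1)/2 + b y(y+1)/2 + c z(z+1)/2}.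
-- Equation multiplied by 2 (avoids division).  For a,b,c ≥ 1 every solution
-- satisfies x(x+1)/2 ≤ n, hence -(n+1) ≤ x ≤ n (same for y,z), so enumerating
-- the box intRange n ^ 3 counts all solutions.
t : ℕ → ℕ → ℕ → ℕ → ℕ
t a b c n = length (filter (λ { (x , y , z) →
    (+ a ℤ.* twoTri x ℤ.+ + b ℤ.* twoTri y ℤ.+ + c ℤ.* twoTri z) ℤ.≟ + (2 ℕ.* n) })
  (triples n))

-- Formal power series in q with ℕ coefficients: Series = ℕ → ℕ
-- (f n = coefficient of q^n).

Series : Set
Series = ℕ → ℕ

_⊕_ : Series → Series → Series
(f ⊕ g) n = f n ℕ.+ g n

_⊛_ : Series → Series → Series
(f ⊛ g) n = sum (map (λ i → f i ℕ.* g (n ℕ.∸ i)) (upTo (suc n)))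

_·_ : ℕ → Series → Series
(k · f) n = k ℕ.* f n

qTimes : Series → Series
qTimes f zero = 0
qTimes f (suc n) = f n

-- substitution q ↦ q^b :  coefficient of q^m in f(q^b)
dil : ℕ → Series → Series
dil b f m = sum (map f (filter (λ k → b ℕ.* k ℕ.≟ m) (upTo (suc m))))

-- ψ(q) = Σ_{k≥0} q^{k(k+1)/2}: coefficient of q^m is #{k ∈ ℕ : k(k+1)/2 = m}
ψ : Series
ψ m = length (filter (λ k → k ℕ.* suc k ℕ.≟ 2 ℕ.* m) (upTo (suc m)))

-- φ(q) = Σ_{k∈ℤ} q^{k²}: coefficient of q^m is #{k ∈ ℤ : k² = m}
φ : Series
φ m = length (filter (λ k → k ℤ.* k ℤ.≟ + m) (intRange m))

module Submission where

-- Both identities are proved by explicit bijections.  With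
-- T35(x,y) = 3x(x+1) + 5y(y+1), the solutions of t(3,5,4b;N) are the (x,y,z)
-- with T35(x,y) + 4b·z(z+1) = 2N, so T35(x,y) ≡ 2N (mod 8).  Factoring T35
-- modulo 8 shows that the pairs with T35 ≡ 6, resp. 2 (mod 8) are exactly the
-- images of explicit linear maps on two copies of ℤ², along which
-- T35 = 4W + 6.  Dividing by 4 (descent) turns the solutions into the pairs
-- (s,z) with W(s) + b·z(z+1) = (2N - 6)/4.  For N = 4n + 3 these are, via a
-- parametrization of ℤ² by the parity of u - v, the solutions of t(3,5,b;n);
-- for N = 4n + 5 they are the weighted objects counted by the series.

open import Defs
open import Data.Bool using (Bool; true; false)
open import Data.Empty using (⊥; ⊥-elim)
open import Data.Integer as ℤ using (ℤ; +_; -[1+_]; +[1+_])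
import Data.Integer.Properties as ZP
open import Data.List using (List; []; _∷_; map; filter; length; upTo; _++_; concatMap)
open import Data.List.Membership.Propositional using (_∈_; mapWith∈; lose)
open import Data.List.Membership.Propositional.Properties
  using (∈-map⁺; ∈-map⁻; ∈-++⁺ˡ; ∈-++⁺ʳ; ∈-++⁻; ∈-filter⁺; ∈-filter⁻; ∈-upTo⁺; ∈-upTo⁻;
         ∈-concatMap⁺; ∈-concatMap⁻; map-mapWith∈; mapWith∈-cong; mapWith∈-id)
open import Data.List.Membership.Propositional.Properties.WithK using (unique∧set⇒bag)
open import Data.List.Membership.Setoid.Properties using (length-mapWith∈)
open import Data.List.Properties using (length-map; length-++)
open import Data.List.Relation.Binary.BagAndSetEquality using (∼bag⇒↭)
open import Data.List.Relation.Binary.Permutation.Propositional.Properties using (↭-length)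
open import Data.List.Relation.Unary.All as All using ([]; _∷_)
import Data.List.Relation.Unary.AllPairs as AllPairs
import Data.List.Relation.Unary.AllPairs.Properties as AllPairsP
import Data.List.Relation.Unary.All.Properties as AllP
open import Data.List.Relation.Unary.Any using (here; there; satisfied)
import Data.List.Relation.Unary.Any.Properties as Any
open import Data.List.Relation.Unary.Unique.Propositional using (Unique; []; _∷_)
open import Data.List.Relation.Binary.Disjoint.Propositional using (Disjoint)
import Data.List.Relation.Unary.Unique.Propositional.Properties as Unique
open import Data.Nat as ℕ using (ℕ; zero; suc; _≤_; s≤s; z≤n; NonZero)
import Data.Nat.Properties as ℕP
import Data.Nat.Tactic.RingSolver as ℕSolver
open import Data.Nat.ListAction using (sum)
open import Data.Product using (Σ; _×_; _,_; proj₁; proj₂)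
open import Data.Sum using (_⊎_; inj₁; inj₂)
open import Data.Unit using (⊤; tt)
open import Function.Base using (_∘_)
open import Function.Bundles using (mk⇔)
open import Relation.Binary.PropositionalEquality
  using (_≡_; refl; sym; trans; cong; cong₂; subst; module ≡-Reasoning)
open import Relation.Nullary using (¬_)
open import Relation.Unary using (Decidable; _⟨⊎⟩_; _⟨×⟩_)

module Counting where
  record Count {A : Set} (P : A → Set) (k : ℕ) : Set where
    constructor count
    field
      elems    : List A
      distinct : Unique elems
      sound    : ∀ {a} → a ∈ elems → P a
      complete : ∀ {a} → P a → a ∈ elems
      size     : length elems ≡ k

  -- Two enumerations of the same set are permutations of each other.
  count-unique : ∀ {A : Set} {P : A → Set} {k k′} → Count P k → Count P k′ → k ≡ k′
  count-unique (count l u s c e) (count l′ u′ s′ c′ e′) =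
    trans (sym e)
      (trans (↭-length (∼bag⇒↭ (unique∧set⇒bag u u′ (mk⇔ (λ m → c′ (s m)) (λ m → c (s′ m)))))) e′)

  count-pullback : ∀ {A B : Set} {P : A → Set} {Q : B → Set} {k} (f : A → B) →
    (∀ {a} → P a → Q (f a)) →
    (∀ {a a′} → P a → P a′ → f a ≡ f a′ → a ≡ a′) →
    (∀ {b} → Q b → Σ A λ a → P a × f a ≡ b) →
    Count Q k → Count P k
  count-pullback {A} {P = P} f P⇒Q inj pre (count l u s c e) =
    count lp distinct sound complete (trans (length-mapWith∈ _ l) e)
    where
    lp : List A
    lp = mapWith∈ l (λ m → proj₁ (pre (s m)))
    f[lp]≡l : map f lp ≡ l
    f[lp]≡l = trans (map-mapWith∈ l _ f)
      (trans (mapWith∈-cong l _ _ (λ m → proj₂ (proj₂ (pre (s m))))) (mapWith∈-id l))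
    distinct : Unique lp
    distinct = Unique.map⁻ (subst Unique (sym f[lp]≡l) u)
    sound : ∀ {a} → a ∈ lp → P a
    sound m with Any.mapWith∈⁻ l _ m
    ... | (b , mb , refl) = proj₁ (proj₂ (pre (s mb)))
    complete : ∀ {a} → P a → a ∈ lp
    complete {a} p = Any.mapWith∈⁺ _ (f a , m , sym (inj p′ p eq))
      where
      m = c (P⇒Q p)
      p′ = proj₁ (proj₂ (pre (s m)))
      eq = proj₂ (proj₂ (pre (s m)))

  count-⇔ : ∀ {A : Set} {P Q : A → Set} {k} → (∀ {a} → P a → Q a) → (∀ {a} → Q a → P a) →
    Count P k → Count Q k
  count-⇔ P⇒Q Q⇒P = count-pullback (λ a → a) Q⇒P (λ _ _ eq → eq) (λ q → _ , P⇒Q q , refl)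

  count-filter : ∀ {A : Set} {P Q : A → Set} (P? : Decidable P) (l : List A) → Unique l →
    (∀ {a} → P a → Q a) → (∀ {a} → Q a → P a) → (∀ {a} → Q a → a ∈ l) →
    Count Q (length (filter P? l))
  count-filter P? l u P⇒Q Q⇒P Q⇒∈ = count (filter P? l) (Unique.filter⁺ P? u)
    (λ m → P⇒Q (proj₂ (∈-filter⁻ P? {xs = l} m))) (λ q → ∈-filter⁺ P? (Q⇒∈ q) (Q⇒P q)) refl

  count-⊎ : ∀ {A B : Set} {P : A → Set} {Q : B → Set} {k m} → Count P k → Count Q m →
    Count (P ⟨⊎⟩ Q) (k ℕ.+ m)
  count-⊎ {P = P} {Q} (count l u s c e) (count r v s′ c′ e′) =
    count (map inj₁ l ++ map inj₂ r)
      (Unique.++⁺ (Unique.map⁺ inj₁-injective u) (Unique.map⁺ inj₂-injective v) disjoint)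
      sound complete
      (trans (length-++ (map inj₁ l))
        (cong₂ ℕ._+_ (trans (length-map inj₁ l) e) (trans (length-map inj₂ r) e′)))
    where
    inj₁-injective : ∀ {a a′} → inj₁ a ≡ inj₁ a′ → a ≡ a′
    inj₁-injective refl = refl
    inj₂-injective : ∀ {b b′} → inj₂ b ≡ inj₂ b′ → b ≡ b′
    inj₂-injective refl = refl
    disjoint : ∀ {e} → ¬ (e ∈ map inj₁ l × e ∈ map inj₂ r)
    disjoint (m₁ , m₂) with ∈-map⁻ inj₁ m₁ | ∈-map⁻ inj₂ m₂
    ... | (_ , _ , refl) | (_ , _ , ())
    sound : ∀ {e} → e ∈ map inj₁ l ++ map inj₂ r → (P ⟨⊎⟩ Q) e
    sound m with ∈-++⁻ (map inj₁ l) m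
    ... | inj₁ m₁ with ∈-map⁻ inj₁ m₁
    ...   | (_ , ma , refl) = s ma
    sound m | inj₂ m₂ with ∈-map⁻ inj₂ m₂
    ...   | (_ , mb , refl) = s′ mb
    complete : ∀ {e} → (P ⟨⊎⟩ Q) e → e ∈ map inj₁ l ++ map inj₂ r
    complete {inj₁ a} p = ∈-++⁺ˡ (∈-map⁺ inj₁ (c p))
    complete {inj₂ b} q = ∈-++⁺ʳ (map inj₁ l) (∈-map⁺ inj₂ (c′ q))

  Indexed : ∀ {X A : Set} → List X → (X → A → Set) → X × A → Set
  Indexed I P (i , a) = i ∈ I × P i a

  count-sum : ∀ {X A : Set} {P : X → A → Set} (f : X → ℕ) (I : List X) → Unique I →
    (∀ i → Count (P i) (f i)) → Count (Indexed I P) (sum (map f I))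
  count-sum f [] [] C = count [] [] (λ ()) (λ { (() , _) }) refl
  count-sum {P = P} f (i ∷ I) (i∉I ∷ uI) C = prepend (C i) (count-sum f I uI C)
    where
    prepend : ∀ {k n} → Count (P i) k → Count (Indexed I P) n → Count (Indexed (i ∷ I) P) (k ℕ.+ n)
    prepend (count l u s c e) (count r v s′ c′ e′) =
      count (map (i ,_) l ++ r)
        (Unique.++⁺ (Unique.map⁺ (cong proj₂) u) v disjoint)
        sound complete
        (trans (length-++ (map (i ,_) l)) (cong₂ ℕ._+_ (trans (length-map (i ,_) l) e) e′))
      where
      disjoint : ∀ {p} → ¬ (p ∈ map (i ,_) l × p ∈ r)
      disjoint (m₁ , m₂) with ∈-map⁻ (i ,_) m₁
      ... | (_ , _ , refl) = All.lookup i∉I (proj₁ (s′ m₂)) refl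
      sound : ∀ {p} → p ∈ map (i ,_) l ++ r → Indexed (i ∷ I) P p
      sound m with ∈-++⁻ (map (i ,_) l) m
      ... | inj₁ m₁ with ∈-map⁻ (i ,_) m₁
      ...   | (_ , ma , refl) = here refl , s ma
      sound m | inj₂ m₂ = there (proj₁ (s′ m₂)) , proj₂ (s′ m₂)
      complete : ∀ {p} → Indexed (i ∷ I) P p → p ∈ map (i ,_) l ++ r
      complete (here refl , p) = ∈-++⁺ˡ (∈-map⁺ (i ,_) (c p))
      complete (there m , p) = ∈-++⁺ʳ (map (i ,_) l) (c′ (m , p))

  count-× : ∀ {A B : Set} {P : A → Set} {Q : B → Set} {k m} → Count P k → Count Q m →
    Count (P ⟨×⟩ Q) (k ℕ.* m)
  count-× {Q = Q} {k} {m} (count l u s c e) CQ =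
    count-⇔ (λ { (a∈l , q) → s a∈l , q }) (λ { (p , q) → c p , q })
      (subst (Count _) sum≡k*m (count-sum {P = λ _ → Q} (λ _ → m) l u (λ _ → CQ)))
    where
    sum-const : ∀ {X : Set} (xs : List X) → sum (map (λ _ → m) xs) ≡ length xs ℕ.* m
    sum-const [] = refl
    sum-const (_ ∷ xs) = cong (m ℕ.+_) (sum-const xs)
    sum≡k*m : sum (map (λ _ → m) l) ≡ k ℕ.* m
    sum≡k*m = trans (sum-const l) (cong (ℕ._* m) e)

open Counting

-- Triangular numbers, and the integers as two copies of ℕ: the generalized
-- triangular number x(x+1)/2 takes the value tri k exactly at x = k and
-- x = -(k+1).
module Triangular where
  open import Data.Integer using (_+_; _*_; _-_; -_)
  open import Data.Integer.Tactic.RingSolver using (solve-∀)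

  tri : ℕ → ℕ
  tri zero = 0
  tri (suc k) = suc k ℕ.+ tri k

  tri-double : ∀ k → k ℕ.* suc k ≡ 2 ℕ.* tri k
  tri-double zero = refl
  tri-double (suc k) = begin
    suc k ℕ.* suc (suc k)        ≡⟨ expand k ⟩
    2 ℕ.* suc k ℕ.+ k ℕ.* suc k  ≡⟨ cong (2 ℕ.* suc k ℕ.+_) (tri-double k) ⟩
    2 ℕ.* suc k ℕ.+ 2 ℕ.* tri k  ≡⟨ sym (ℕP.*-distribˡ-+ 2 (suc k) (tri k)) ⟩
    2 ℕ.* tri (suc k)            ∎
    where
    open ≡-Reasoning
    expand : ∀ k → suc k ℕ.* suc (suc k) ≡ 2 ℕ.* suc k ℕ.+ k ℕ.* suc k
    expand = ℕSolver.solve-∀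

  k≤tri : ∀ k → k ≤ tri k
  k≤tri zero = z≤n
  k≤tri (suc k) = ℕP.m≤m+n (suc k) (tri k)

  fold : ℤ → ℕ
  fold (+ k) = k
  fold -[1+ k ] = k

  reflect : ℤ → ℤ
  reflect y = - y - + 1

  reflect-involutive : ∀ y → reflect (reflect y) ≡ y
  reflect-involutive = identity
    where
    identity : ∀ y → - (- y - + 1) - + 1 ≡ y
    identity = solve-∀

  twoTri-reflect : ∀ y → twoTri (reflect y) ≡ twoTri y
  twoTri-reflect = identity
    where
    identity : ∀ y → (- y - + 1) * ((- y - + 1) + + 1) ≡ y * (y + + 1)
    identity = solve-∀

  triℤ : ℤ → ℕ
  triℤ x = tri (fold x)

  twoTri-triℤ : ∀ x → twoTri x ≡ + 2 * + triℤ x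
  twoTri-triℤ (+ k) = begin
    + k * + (k ℕ.+ 1)     ≡⟨ sym (ZP.pos-* k (k ℕ.+ 1)) ⟩
    + (k ℕ.* (k ℕ.+ 1))   ≡⟨ cong (λ j → + (k ℕ.* j)) (ℕP.+-comm k 1) ⟩
    + (k ℕ.* suc k)       ≡⟨ cong +_ (tri-double k) ⟩
    + (2 ℕ.* tri k)       ≡⟨ ZP.pos-* 2 (tri k) ⟩
    + 2 * + tri k         ∎
    where open ≡-Reasoning
  twoTri-triℤ -[1+ k ] = begin
    twoTri -[1+ k ]       ≡⟨ cong twoTri (negative≡reflect k) ⟩
    twoTri (reflect (+ k)) ≡⟨ twoTri-reflect (+ k) ⟩
    twoTri (+ k)          ≡⟨ twoTri-triℤ (+ k) ⟩
    + 2 * + tri k         ∎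
    where
    open ≡-Reasoning
    negative≡reflect : ∀ k → -[1+ k ] ≡ reflect (+ k)
    negative≡reflect zero = refl
    negative≡reflect (suc k) = cong -[1+_] (cong suc (sym (ℕP.+-identityʳ k)))

  signed : Bool → ℕ → ℤ
  signed false k = + k
  signed true k = -[1+ k ]

  fold-signed : ∀ s k → fold (signed s k) ≡ k
  fold-signed false k = refl
  fold-signed true k = refl

  sign-split : ℤ → Bool × ℕ
  sign-split (+ k) = false , k
  sign-split -[1+ k ] = true , k

  split-signed : ∀ s k → sign-split (signed s k) ≡ (s , k)
  split-signed false k = refl
  split-signed true k = refl

  signed-split : ∀ z → signed (proj₁ (sign-split z)) (proj₂ (sign-split z)) ≡ z
  signed-split (+ k) = refl
  signed-split -[1+ k ] = refl

  sq : ℤ → ℕ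
  sq a = ℤ.∣ a ∣ ℕ.* ℤ.∣ a ∣

  square-sq : ∀ a → a * a ≡ + sq a
  square-sq (+ zero) = refl
  square-sq +[1+ k ] = refl
  square-sq -[1+ k ] = refl

  fold≤sq : ∀ a → fold a ≤ sq a
  fold≤sq (+ zero) = z≤n
  fold≤sq +[1+ k ] = ℕP.m≤m*n (suc k) (suc k)
  fold≤sq -[1+ k ] = ℕP.≤-trans (ℕP.n≤1+n k) (ℕP.m≤m*n (suc k) (suc k))

open Triangular

module Enumeration where

  intRange-unique : ∀ m → Unique (intRange m)
  intRange-unique m = Unique.++⁺ (Unique.map⁺ ZP.-[1+-injective (Unique.upTo⁺ _))
    (Unique.map⁺ ZP.+-injective (Unique.upTo⁺ _)) disjoint
    where
    disjoint : ∀ {x} → ¬ (x ∈ map -[1+_] (upTo (suc m)) × x ∈ map +_ (upTo (suc m)))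
    disjoint (m₁ , m₂) with ∈-map⁻ -[1+_] m₁ | ∈-map⁻ +_ m₂
    ... | (_ , _ , refl) | (_ , _ , ())

  ∈-intRange : ∀ {m} x → fold x ≤ m → x ∈ intRange m
  ∈-intRange {m} (+ k) k≤m = ∈-++⁺ʳ (map -[1+_] (upTo (suc m))) (∈-map⁺ +_ (∈-upTo⁺ (s≤s k≤m)))
  ∈-intRange -[1+ k ] k≤m = ∈-++⁺ˡ (∈-map⁺ -[1+_] (∈-upTo⁺ (s≤s k≤m)))

  concatMap-unique : ∀ {A B : Set} (f : A → List B) {xs : List A} → Unique xs →
    (∀ x → Unique (f x)) → (∀ {x x′ b} → b ∈ f x → b ∈ f x′ → x ≡ x′) →
    Unique (concatMap f xs)
  concatMap-unique f u f-unique separated =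
    Unique.concat⁺ (AllP.map⁺ (All.tabulate (λ {x} _ → f-unique x)))
      (AllPairsP.map⁺ (AllPairs.map {S = λ x x′ → Disjoint (f x) (f x′)}
        (λ x≢x′ (m₁ , m₂) → x≢x′ (separated m₁ m₂)) u))

  line : ℕ → ℤ → ℤ → List (ℤ × ℤ × ℤ)
  line m x y = map (λ z → x , y , z) (intRange m)

  row : ℕ → ℤ → List (ℤ × ℤ × ℤ)
  row m x = concatMap (line m x) (intRange m)

  on-line : ∀ {m x y p} → p ∈ line m x y → proj₁ p ≡ x × proj₁ (proj₂ p) ≡ y
  on-line {x = x} {y} p∈ with ∈-map⁻ (λ z → x , y , z) p∈
  ... | (_ , _ , refl) = refl , refl

  on-row : ∀ {m x p} → p ∈ row m x → proj₁ p ≡ x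
  on-row {m} {x} p∈ with satisfied (∈-concatMap⁻ (line m x) {xs = intRange m} p∈)
  ... | (_ , p∈line) = proj₁ (on-line {m} p∈line)

  triples-unique : ∀ m → Unique (triples m)
  triples-unique m = concatMap-unique (row m) (intRange-unique m) row-unique
    (λ p∈ p∈′ → trans (sym (on-row {m} p∈)) (on-row {m} p∈′))
    where
    row-unique : ∀ x → Unique (row m x)
    row-unique x = concatMap-unique (line m x) (intRange-unique m)
      (λ y → Unique.map⁺ (cong (λ p → proj₂ (proj₂ p))) (intRange-unique m))
      (λ p∈ p∈′ → trans (sym (proj₂ (on-line {m} p∈))) (proj₂ (on-line {m} p∈′)))

  ∈-triples : ∀ {m x y z} → x ∈ intRange m → y ∈ intRange m → z ∈ intRange m →
    (x , y , z) ∈ triples m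
  ∈-triples {m} {x} {y} x∈ y∈ z∈ =
    ∈-concatMap⁺ (row m) (lose x∈ (∈-concatMap⁺ (line m x) (lose y∈ (∈-map⁺ (λ z → x , y , z) z∈))))

open Enumeration

-- Series as generating functions of weighted sets: F is the generating
-- function of the weight w : A → ℕ when, for every m, exactly F m elements
-- have weight m.
module Fibres where
  open import Data.Nat using (_+_; _*_; _∸_; _≟_)
  open import Data.Sum using ([_,_]′)

  Fib : ∀ {A : Set} → (A → ℕ) → Series → Set
  Fib w F = ∀ m → Count (λ a → w a ≡ m) (F m)

  ψ-fib : Fib tri ψ
  ψ-fib m = count-filter (λ k → k * suc k ≟ 2 * m) (upTo (suc m)) (Unique.upTo⁺ _)
    (λ {k} e → ℕP.*-cancelˡ-≡ (tri k) m 2 (trans (sym (tri-double k)) e))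
    (λ {k} e → trans (tri-double k) (cong (2 *_) e))
    (λ {k} e → ∈-upTo⁺ (s≤s (subst (k ≤_) e (k≤tri k))))

  φ-fib : Fib sq φ
  φ-fib m = count-filter (λ a → a ℤ.* a ℤ.≟ + m) (intRange m) (intRange-unique m)
    (λ {a} e → ZP.+-injective (trans (sym (square-sq a)) e))
    (λ {a} e → trans (square-sq a) (cong +_ e))
    (λ {a} e → ∈-intRange a (subst (fold a ≤_) e (fold≤sq a)))

  conv-fib : ∀ {A B : Set} {v : A → ℕ} {w : B → ℕ} {F G : Series} → Fib v F → Fib w G →
    Fib (λ (p : A × B) → v (proj₁ p) + w (proj₂ p)) (F ⊛ G)
  conv-fib {A} {B} {v} {w} {F} {G} fF fG n =
    count-pullback (λ p → v (proj₁ p) , p) total⇒split (λ _ _ → cong proj₂) split⇒total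
      (count-sum (λ i → F i * G (n ∸ i)) (upTo (suc n)) (Unique.upTo⁺ _)
        (λ i → count-× (fF i) (fG (n ∸ i))))
    where
    total⇒split : ∀ {p} → v (proj₁ p) + w (proj₂ p) ≡ n →
      v (proj₁ p) ∈ upTo (suc n) × (v (proj₁ p) ≡ v (proj₁ p) × w (proj₂ p) ≡ n ∸ v (proj₁ p))
    total⇒split {a , b} e =
      ∈-upTo⁺ (s≤s (subst (v a ≤_) e (ℕP.m≤m+n (v a) (w b)))) ,
      refl , trans (sym (ℕP.m+n∸m≡n (v a) (w b))) (cong (_∸ v a) e)
    split⇒total : ∀ {q} → Indexed (upTo (suc n)) (λ i → (λ a → v a ≡ i) ⟨×⟩ (λ b → w b ≡ n ∸ i)) q →
      Σ (A × B) λ p → v (proj₁ p) + w (proj₂ p) ≡ n × (v (proj₁ p) , p) ≡ q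
    split⇒total {i , (a , b)} (i∈ , vi , wi) =
      (a , b) , trans (cong₂ _+_ vi wi) (ℕP.m+[n∸m]≡n (ℕP.≤-pred (∈-upTo⁻ i∈))) ,
      cong (_, (a , b)) vi

  dil-fib : ∀ {A : Set} {v : A → ℕ} {F : Series} (d : ℕ) .{{_ : NonZero d}} → Fib v F →
    Fib (λ a → d * v a) (dil d F)
  dil-fib {A} {v} {F} d fF m =
    count-pullback (λ a → v a , a) scaled⇒indexed (λ _ _ → cong proj₂) indexed⇒scaled
      (count-sum F multiples (Unique.filter⁺ (λ k → d * k ≟ m) (Unique.upTo⁺ _)) fF)
    where
    multiples : List ℕ
    multiples = filter (λ k → d * k ≟ m) (upTo (suc m))
    scaled⇒indexed : ∀ {a} → d * v a ≡ m → v a ∈ multiples × v a ≡ v a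
    scaled⇒indexed {a} e =
      ∈-filter⁺ (λ k → d * k ≟ m) (∈-upTo⁺ (s≤s (subst (v a ≤_) e (ℕP.m≤n*m (v a) d)))) e , refl
    indexed⇒scaled : ∀ {q} → Indexed multiples (λ k a → v a ≡ k) q →
      Σ A λ a → d * v a ≡ m × (v a , a) ≡ q
    indexed⇒scaled {k , a} (k∈ , vk) =
      a , trans (cong (d *_) vk) (proj₂ (∈-filter⁻ (λ k → d * k ≟ m) {xs = upTo (suc m)} k∈)) ,
      cong (_, a) vk

  ⊕-fib : ∀ {A B : Set} {v : A → ℕ} {w : B → ℕ} {F G : Series} → Fib v F → Fib w G →
    Fib [ v , w ]′ (F ⊕ G)
  ⊕-fib fF fG m = count-⇔
    (λ { {inj₁ _} e → e ; {inj₂ _} e → e })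
    (λ { {inj₁ _} e → e ; {inj₂ _} e → e })
    (count-⊎ (fF m) (fG m))

  qTimes-fib : ∀ {A : Set} {v : A → ℕ} {F : Series} → Fib v F → Fib (λ a → suc (v a)) (qTimes F)
  qTimes-fib fF zero = count [] [] (λ ()) (λ ()) refl
  qTimes-fib fF (suc m) = count-⇔ (cong suc) ℕP.suc-injective (fF m)

  double-fib : ∀ {A : Set} {v : A → ℕ} {F : Series} → Fib v F →
    Fib (λ (p : Bool × A) → v (proj₂ p)) (2 · F)
  double-fib fF m = count-⇔ proj₂ (λ e → tt , e) (count-× booleans (fF m))
    where
    booleans : Count (λ (_ : Bool) → ⊤) 2
    booleans = count (false ∷ true ∷ []) (((λ ()) ∷ []) ∷ [] ∷ []) (λ _ → tt)
      (λ { {false} _ → here refl ; {true} _ → there (here refl) }) refl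

open Fibres

module Solutions where
  open import Data.Nat using (_+_; _*_)

  Sol : ℕ → ℕ → ℕ → ℕ → ℤ × ℤ × ℤ → Set
  Sol a b c N (x , y , z) = + a ℤ.* twoTri x ℤ.+ + b ℤ.* twoTri y ℤ.+ + c ℤ.* twoTri z ≡ + (2 * N)

  Sol⇒ℕ : ∀ {a b c N x y z} → Sol a b c N (x , y , z) →
    a * (2 * triℤ x) + b * (2 * triℤ y) + c * (2 * triℤ z) ≡ 2 * N
  Sol⇒ℕ {a} {b} {c} {N} {x} {y} {z} e = ZP.+-injective (begin
    + (a * (2 * triℤ x) + b * (2 * triℤ y) + c * (2 * triℤ z))
      ≡⟨ ZP.pos-+ (a * (2 * triℤ x) + b * (2 * triℤ y)) _ ⟩
    + (a * (2 * triℤ x) + b * (2 * triℤ y)) ℤ.+ + (c * (2 * triℤ z))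
      ≡⟨ cong₂ ℤ._+_ (ZP.pos-+ (a * (2 * triℤ x)) _) (term c z) ⟩
    + (a * (2 * triℤ x)) ℤ.+ + (b * (2 * triℤ y)) ℤ.+ + c ℤ.* twoTri z
      ≡⟨ cong₂ (λ X Y → X ℤ.+ Y ℤ.+ + c ℤ.* twoTri z) (term a x) (term b y) ⟩
    + a ℤ.* twoTri x ℤ.+ + b ℤ.* twoTri y ℤ.+ + c ℤ.* twoTri z
      ≡⟨ e ⟩
    + (2 * N) ∎)
    where
    open ≡-Reasoning
    term : ∀ k u → + (k * (2 * triℤ u)) ≡ + k ℤ.* twoTri u
    term k u = trans (ZP.pos-* k (2 * triℤ u))
      (cong (+ k ℤ.*_) (trans (ZP.pos-* 2 (triℤ u)) (sym (twoTri-triℤ u))))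

  in-range : ∀ {N} k x .{{_ : NonZero k}} → k * (2 * triℤ x) ≤ 2 * N → x ∈ intRange N
  in-range {N} k x bound = ∈-intRange x (ℕP.≤-trans (k≤tri (fold x))
    (ℕP.*-cancelˡ-≤ 2 (ℕP.≤-trans (ℕP.m≤n*m (2 * triℤ x) k) bound)))

  count-t : ∀ a b c N .{{_ : NonZero a}} .{{_ : NonZero b}} .{{_ : NonZero c}} →
    Count (Sol a b c N) (t a b c N)
  count-t a b c N = count-filter solution? (triples N) (triples-unique N) (λ e → e) (λ e → e) solution∈
    where
    solution? : Decidable (Sol a b c N)
    solution? p = + a ℤ.* twoTri (proj₁ p) ℤ.+ + b ℤ.* twoTri (proj₁ (proj₂ p))
      ℤ.+ + c ℤ.* twoTri (proj₂ (proj₂ p)) ℤ.≟ + (2 * N)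
    solution∈ : ∀ {p} → Sol a b c N p → p ∈ triples N
    solution∈ {x , y , z} e = ∈-triples {N}
      (in-range {N} a x (ℕP.≤-trans (ℕP.≤-trans (ℕP.m≤m+n X Y) (ℕP.m≤m+n (X + Y) Z)) total))
      (in-range {N} b y (ℕP.≤-trans (ℕP.≤-trans (ℕP.m≤n+m Y X) (ℕP.m≤m+n (X + Y) Z)) total))
      (in-range {N} c z (ℕP.≤-trans (ℕP.m≤n+m Z (X + Y)) total))
      where
      X = a * (2 * triℤ x)
      Y = b * (2 * triℤ y)
      Z = c * (2 * triℤ z)
      total : X + Y + Z ≤ 2 * N
      total = ℕP.≤-reflexive (Sol⇒ℕ {a} {b} {c} {N} {x} {y} {z} e)

open Solutions

module Congruences where
  open import Data.Integer using (_+_; _*_; _-_; -_)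
  open import Data.Integer.DivMod using (_/_; _%_; a≡a%n+[a/n]*n; n%d<d)
  open import Data.Integer.Divisibility.Signed
    using (_∣_; divides; ∣⇒∣ᵤ; ∣m⇒∣m*n; ∣m∣n⇒∣m-n; ∣m∣n⇒∣m+n; ∣m+n∣n⇒∣m)
  open import Data.Integer.Tactic.RingSolver using (solve-∀)
  import Data.Nat.Divisibility as ℕDiv

  Even Odd : ℤ → Set
  Even m = Σ ℤ λ w → m ≡ w * + 2
  Odd m = Σ ℤ λ w → m ≡ w * + 2 + + 1

  parity : ∀ m → Even m ⊎ Odd m
  parity m with m % + 2 | a≡a%n+[a/n]*n m (+ 2) | n%d<d m (+ 2)
  ... | 0 | m≡ | _ = inj₁ (m / + 2 , trans m≡ (ZP.+-identityˡ _))
  ... | 1 | m≡ | _ = inj₂ (m / + 2 , trans m≡ (ZP.+-comm (+ 1) ((m / + 2) * + 2)))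
  ... | suc (suc _) | _ | s≤s (s≤s ())

  even-odd-disjoint : ∀ {m} → Even m → Odd m → ⊥
  even-odd-disjoint {m} (w , m≡2w) (w′ , m≡2w′+1) = 2∤1 (divides (w - w′) (begin
    + 1                           ≡⟨ isolate w w′ ⟩
    (w′ * + 2 + + 1) - w′ * + 2   ≡⟨ cong (_- w′ * + 2) (trans (sym m≡2w′+1) m≡2w) ⟩
    w * + 2 - w′ * + 2            ≡⟨ factor w w′ ⟩
    (w - w′) * + 2                ∎))
    where
    open ≡-Reasoning
    2∤1 : ¬ (+ 2 ∣ + 1)
    2∤1 d with ℕDiv.∣1⇒≡1 (∣⇒∣ᵤ d)
    ... | ()
    isolate : ∀ w w′ → + 1 ≡ (w′ * + 2 + + 1) - w′ * + 2
    isolate = solve-∀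
    factor : ∀ w w′ → w * + 2 - w′ * + 2 ≡ (w - w′) * + 2
    factor = solve-∀

  -- Odd numbers are units modulo 8, since (2w+1)² = 1 + 8·tri(w).
  odd-cancel : ∀ a k → Odd k → + 8 ∣ a * k → + 8 ∣ a
  odd-cancel a k (w , refl) 8∣ak =
    subst (+ 8 ∣_) (sym a≡) (∣m∣n⇒∣m-n (∣m⇒∣m*n k 8∣ak) (divides (a * + triℤ w) refl))
    where
    open ≡-Reasoning
    expand : ∀ a w → a ≡ a * (w * + 2 + + 1) * (w * + 2 + + 1) - a * (+ 4 * (w * (w + + 1)))
    expand = solve-∀
    regroup : ∀ a T → a * (+ 4 * (+ 2 * T)) ≡ (a * T) * + 8
    regroup = solve-∀
    a≡ : a ≡ a * (w * + 2 + + 1) * (w * + 2 + + 1) - (a * + triℤ w) * + 8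
    a≡ = begin
      a                                                        ≡⟨ expand a w ⟩
      a * (w * + 2 + + 1) * (w * + 2 + + 1) - a * (+ 4 * twoTri w)
        ≡⟨ cong (λ T → a * (w * + 2 + + 1) * (w * + 2 + + 1) - a * (+ 4 * T)) (twoTri-triℤ w) ⟩
      a * (w * + 2 + + 1) * (w * + 2 + + 1) - a * (+ 4 * (+ 2 * + triℤ w))
        ≡⟨ cong (λ X → a * (w * + 2 + + 1) * (w * + 2 + + 1) - X) (regroup a (+ triℤ w)) ⟩
      a * (w * + 2 + + 1) * (w * + 2 + + 1) - (a * + triℤ w) * + 8 ∎

  -- If a - b is odd, one of a, b is odd; so 8 ∣ ab forces 8 ∣ a or 8 ∣ b.
  product-split : ∀ a b → Odd (a - b) → + 8 ∣ a * b → + 8 ∣ a ⊎ + 8 ∣ b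
  product-split a b (v , a-b≡) 8∣ab with parity b
  ... | inj₂ b-odd = inj₁ (odd-cancel a b b-odd 8∣ab)
  ... | inj₁ (w , b≡) = inj₂ (odd-cancel b a a-odd (subst (+ 8 ∣_) (ZP.*-comm a b) 8∣ab))
    where
    recombine : ∀ a b v w → a - b ≡ v * + 2 + + 1 → b ≡ w * + 2 → a ≡ (v + w) * + 2 + + 1
    recombine a b v w e₁ e₂ = begin
      a                               ≡⟨ split a b ⟩
      (a - b) + b                     ≡⟨ cong₂ _+_ e₁ e₂ ⟩
      v * + 2 + + 1 + w * + 2         ≡⟨ collect v w ⟩
      (v + w) * + 2 + + 1             ∎
      where
      open ≡-Reasoning
      split : ∀ a b → a ≡ (a - b) + b
      split = solve-∀
      collect : ∀ v w → v * + 2 + + 1 + w * + 2 ≡ (v + w) * + 2 + + 1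
      collect = solve-∀
    a-odd : Odd a
    a-odd = v + w , recombine a b v w a-b≡ b≡

  factor-mod8 : ∀ e a b c K → e ≡ a * b * c + K * + 8 → Odd c → Odd (a - b) →
    + 8 ∣ e → + 8 ∣ a ⊎ + 8 ∣ b
  factor-mod8 e a b c K e≡ c-odd a-b-odd 8∣e =
    product-split a b a-b-odd (odd-cancel (a * b) c c-odd
      (∣m+n∣n⇒∣m (subst (+ 8 ∣_) e≡ 8∣e) (divides K refl)))

  shift-mod8 : ∀ a b c k → b ≡ c + k * + 8 → + 8 ∣ a - b → + 8 ∣ a - c
  shift-mod8 a b c k b≡ 8∣a-b =
    subst (+ 8 ∣_) (regroup a c k)
      (∣m∣n⇒∣m+n (subst (λ B → + 8 ∣ a - B) b≡ 8∣a-b) (divides k refl))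
    where
    regroup : ∀ a c k → a - (c + k * + 8) + k * + 8 ≡ a - c
    regroup = solve-∀

  T35 : ℤ → ℤ → ℤ
  T35 x y = + 3 * twoTri x + + 5 * twoTri y

  residue-6 : ∀ x y → + 8 ∣ T35 x y - + 6 → + 8 ∣ y - + 3 * x - + 5 ⊎ + 8 ∣ y + + 3 * x - + 2
  residue-6 x y = factor-mod8 _ (y - + 3 * x - + 5) (y + + 3 * x - + 2) (+ 5)
    (+ 6 * (x * x) + + 6 * x + + 5 * y - + 7) (identity x y) (+ 2 , refl) (- (+ 3 * x) - + 2 , difference x y)
    where
    identity : ∀ x y → + 3 * (x * (x + + 1)) + + 5 * (y * (y + + 1)) - + 6
      ≡ (y - + 3 * x - + 5) * (y + + 3 * x - + 2) * + 5 + (+ 6 * (x * x) + + 6 * x + + 5 * y - + 7) * + 8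
    identity = solve-∀
    difference : ∀ x y → (y - + 3 * x - + 5) - (y + + 3 * x - + 2) ≡ (- (+ 3 * x) - + 2) * + 2 + + 1
    difference = solve-∀

  residue-2 : ∀ x y → + 8 ∣ T35 x y - + 2 → + 8 ∣ x - + 5 * y - + 2 ⊎ + 8 ∣ x + + 5 * y + + 3
  residue-2 x y = factor-mod8 _ (x - + 5 * y - + 2) (x + + 5 * y + + 3) (+ 3)
    (+ 10 * (y * (y + + 1)) + + 2) (identity x y) (+ 1 , refl) (- (+ 5 * y) - + 3 , difference x y)
    where
    identity : ∀ x y → + 3 * (x * (x + + 1)) + + 5 * (y * (y + + 1)) - + 2
      ≡ (x - + 5 * y - + 2) * (x + + 5 * y + + 3) * + 3 + (+ 10 * (y * (y + + 1)) + + 2) * + 8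
    identity = solve-∀
    difference : ∀ x y → (x - + 5 * y - + 2) - (x + + 5 * y + + 3) ≡ (- (+ 5 * y) - + 3) * + 2 + + 1
    difference = solve-∀

open Congruences

-- Suppose μ : S → ℤ² parametrizes,
-- bijectively, the pairs (x,y) with T35(x,y) ≡ 2N (mod 8), and
-- T35(μ s) = 4·W(s) + 6.  Then the solutions (x,y,z) of
-- T35(x,y) + 4c·z(z+1) = 2N correspond to the pairs (s,z) with
-- 4(W(s) + c·z(z+1)) + 6 = 2N: the factor 4 has been divided out.
module Descent where
  open import Data.Integer using (_+_; _*_; _-_; -_)
  open import Data.Integer.Divisibility.Signed using (_∣_; divides)
  open import Data.Integer.Tactic.RingSolver using (solve-∀)

  extend : ℤ × ℤ → ℤ → ℤ × ℤ × ℤ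
  extend (x , y) z = x , y , z

  extend-injective : ∀ {S : Set} (μ : S → ℤ × ℤ) → (∀ {s s′} → μ s ≡ μ s′ → s ≡ s′) →
    ∀ {s s′ z z′} → extend (μ s) z ≡ extend (μ s′) z′ → (s , z) ≡ (s′ , z′)
  extend-injective μ μ-injective eq =
    cong₂ _,_ (μ-injective (cong (λ q → proj₁ q , proj₁ (proj₂ q)) eq))
              (cong (λ q → proj₂ (proj₂ q)) eq)

  affine-injective : ∀ a b → + 4 * a + + 6 ≡ + 4 * b + + 6 → a ≡ b
  affine-injective a b eq = ZP.*-cancelˡ-≡ (+ 4) a b (begin
    + 4 * a                ≡⟨ drop6 (+ 4 * a) ⟩
    + 4 * a + + 6 - + 6    ≡⟨ cong (_- + 6) eq ⟩
    + 4 * b + + 6 - + 6    ≡⟨ sym (drop6 (+ 4 * b)) ⟩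
    + 4 * b                ∎)
    where
    open ≡-Reasoning
    drop6 : ∀ a → a ≡ a + + 6 - + 6
    drop6 = solve-∀

  Descended : ∀ {S : Set} → (S → ℤ) → ℕ → ℕ → S × ℤ → Set
  Descended W c N (s , z) = + 4 * (W s + + c * twoTri z) + + 6 ≡ + (2 ℕ.* N)

  descent : ∀ {S : Set} (μ : S → ℤ × ℤ) (W : S → ℤ) (c N : ℕ) →
    (∀ s → T35 (proj₁ (μ s)) (proj₂ (μ s)) ≡ + 4 * W s + + 6) →
    (∀ {s s′} → μ s ≡ μ s′ → s ≡ s′) →
    (∀ {x y} → + 8 ∣ T35 x y - + (2 ℕ.* N) → Σ S λ s → μ s ≡ (x , y)) →
    ∀ {k} → Count (Sol 3 5 (4 ℕ.* c) N) k → Count (Descended W c N) k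
  descent {S} μ W c N weight μ-injective μ-onto =
    count-pullback (λ p → extend (μ (proj₁ p)) (proj₂ p))
      (λ {p} d → trans (sol≡ (proj₁ p) (proj₂ p)) d)
      (λ _ _ → extend-injective μ μ-injective)
      preimage
    where
    open ≡-Reasoning
    sol≡ : ∀ s z → T35 (proj₁ (μ s)) (proj₂ (μ s)) + + (4 ℕ.* c) * twoTri z
                   ≡ + 4 * (W s + + c * twoTri z) + + 6
    sol≡ s z = begin
      T35 (proj₁ (μ s)) (proj₂ (μ s)) + + (4 ℕ.* c) * twoTri z
        ≡⟨ cong₂ (λ T C → T + C * twoTri z) (weight s) (ZP.pos-* 4 c) ⟩
      + 4 * W s + + 6 + + 4 * + c * twoTri z
        ≡⟨ regroup (W s) (+ c) (twoTri z) ⟩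
      + 4 * (W s + + c * twoTri z) + + 6 ∎
      where
      regroup : ∀ W C Z → + 4 * W + + 6 + + 4 * C * Z ≡ + 4 * (W + C * Z) + + 6
      regroup = solve-∀
    preimage : ∀ {p} → Sol 3 5 (4 ℕ.* c) N p →
      Σ (S × ℤ) λ q → Descended W c N q × extend (μ (proj₁ q)) (proj₂ q) ≡ p
    preimage {x , y , z} sol with μ-onto {x} {y} (divides (- (+ c * + triℤ z)) residue)
      where
      residue : T35 x y - + (2 ℕ.* N) ≡ - (+ c * + triℤ z) * + 8
      residue = begin
        T35 x y - + (2 ℕ.* N)
          ≡⟨ cong (λ R → T35 x y - R) (sym sol) ⟩
        T35 x y - (T35 x y + + (4 ℕ.* c) * twoTri z)
          ≡⟨ cong₂ (λ C Z → T35 x y - (T35 x y + C * Z)) (ZP.pos-* 4 c) (twoTri-triℤ z) ⟩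
        T35 x y - (T35 x y + + 4 * + c * (+ 2 * + triℤ z))
          ≡⟨ cancel (T35 x y) (+ c) (+ triℤ z) ⟩
        - (+ c * + triℤ z) * + 8 ∎
        where
        cancel : ∀ T C R → T - (T + + 4 * C * (+ 2 * R)) ≡ - (C * R) * + 8
        cancel = solve-∀
    ... | s , μs≡xy = (s , z) ,
      trans (sym (sol≡ s z))
        (trans (cong (λ q → T35 (proj₁ q) (proj₂ q) + + (4 ℕ.* c) * twoTri z) μs≡xy) sol) ,
      cong (λ q → extend q z) μs≡xy

open Descent

module Parametrizations where
  open import Data.Integer using (_*_; _-_)

  Split : Set
  Split = (ℤ × ℤ) ⊎ (ℤ × ℤ)

  recover : ∀ (μ : ℤ × ℤ → ℤ × ℤ) (D₁ D₂ : ℤ → ℤ → ℤ) (m : ℤ) .{{_ : ℤ.NonZero m}} →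
    (∀ v w → D₁ (proj₁ (μ (v , w))) (proj₂ (μ (v , w))) ≡ v * m) →
    (∀ v w → D₂ (proj₁ (μ (v , w))) (proj₂ (μ (v , w))) ≡ w * m) →
    ∀ {p q} → μ p ≡ μ q → p ≡ q
  recover μ D₁ D₂ m D₁≡ D₂≡ {v , w} {v′ , w′} eq = cong₂ _,_
    (ZP.*-cancelʳ-≡ v v′ m (trans (sym (D₁≡ v w)) (trans (apply D₁) (D₁≡ v′ w′))))
    (ZP.*-cancelʳ-≡ w w′ m (trans (sym (D₂≡ v w)) (trans (apply D₂) (D₂≡ v′ w′))))
    where
    apply : ∀ D → D (proj₁ (μ (v , w))) (proj₂ (μ (v , w))) ≡ D (proj₁ (μ (v′ , w′))) (proj₂ (μ (v′ , w′)))
    apply D = cong (λ q → D (proj₁ q) (proj₂ q)) eq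

  difference : ℤ × ℤ → ℤ
  difference (x , y) = x - y

  parity-separates : ∀ {A : Set} (f : A → ℤ) {a b} → Even (f a) → Odd (f b) → a ≡ b → ⊥
  parity-separates f ev od refl = even-odd-disjoint ev od

open Parametrizations

-- The pairs (x,y) with
-- T35(x,y) ≡ 6 (mod 8) are β(s), the pairs (u,v) are α(s), and
-- T35(β s) = 4·T35(α s) + 6, so descent identifies both solution sets.
module PartA where
  open import Data.Integer using (_+_; _*_; _-_; -_)
  open import Data.Integer.Divisibility.Signed using (_∣_; divides)
  open import Data.Integer.Tactic.RingSolver using (solve-∀)
  open ≡-Reasoning

  α : Split → ℤ × ℤ
  α (inj₁ (v , w)) = v + + 2 * w , v
  α (inj₂ (v , w)) = v + + 2 * w + + 1 , v

  -- (x , y) with y ≡ 2 - 3x, resp. y ≡ 3x + 5 (mod 8).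
  β : Split → ℤ × ℤ
  β (inj₁ (v , w)) = - (+ 3 * v) - w - + 2 , v + + 3 * w
  β (inj₂ (v , w)) = w - + 2 * v - + 1 , + 2 * v + + 3 * w + + 2

  Tα : Split → ℤ
  Tα s = T35 (proj₁ (α s)) (proj₂ (α s))

  β-weight : ∀ s → T35 (proj₁ (β s)) (proj₂ (β s)) ≡ + 4 * Tα s + + 6
  β-weight (inj₁ (v , w)) = identity v w
    where
    identity : ∀ v w →
      + 3 * ((- (+ 3 * v) - w - + 2) * ((- (+ 3 * v) - w - + 2) + + 1))
        + + 5 * ((v + + 3 * w) * ((v + + 3 * w) + + 1))
      ≡ + 4 * (+ 3 * ((v + + 2 * w) * ((v + + 2 * w) + + 1)) + + 5 * (v * (v + + 1))) + + 6
    identity = solve-∀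
  β-weight (inj₂ (v , w)) = identity v w
    where
    identity : ∀ v w →
      + 3 * ((w - + 2 * v - + 1) * ((w - + 2 * v - + 1) + + 1))
        + + 5 * ((+ 2 * v + + 3 * w + + 2) * ((+ 2 * v + + 3 * w + + 2) + + 1))
      ≡ + 4 * (+ 3 * ((v + + 2 * w + + 1) * ((v + + 2 * w + + 1) + + 1)) + + 5 * (v * (v + + 1))) + + 6
    identity = solve-∀

  α-difference₁ : ∀ v w → (v + + 2 * w) - v ≡ w * + 2
  α-difference₁ = solve-∀

  α-difference₂ : ∀ v w → (v + + 2 * w + + 1) - v ≡ w * + 2 + + 1
  α-difference₂ = solve-∀

  α-injective : ∀ {s s′} → α s ≡ α s′ → s ≡ s′
  α-injective {inj₁ _} {inj₁ _} eq =
    cong inj₁ (recover (λ p → α (inj₁ p)) (λ x y → y * + 2) (λ x y → x - y) (+ 2) (λ _ _ → refl) α-difference₁ eq)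
  α-injective {inj₂ _} {inj₂ _} eq =
    cong inj₂ (recover (λ p → α (inj₂ p)) (λ x y → y * + 2) (λ x y → x - y - + 1) (+ 2) (λ _ _ → refl) shifted eq)
    where
    shifted : ∀ v w → (v + + 2 * w + + 1) - v - + 1 ≡ w * + 2
    shifted = solve-∀
  α-injective {inj₁ (v , w)} {inj₂ (v′ , w′)} eq =
    ⊥-elim (parity-separates difference (w , α-difference₁ v w) (w′ , α-difference₂ v′ w′) eq)
  α-injective {inj₂ (v , w)} {inj₁ (v′ , w′)} eq =
    ⊥-elim (parity-separates difference (w′ , α-difference₁ v′ w′) (w , α-difference₂ v w) (sym eq))

  α-onto : ∀ u v → Σ Split λ s → α s ≡ (u , v)
  α-onto u v with parity (u - v)
  ... | inj₁ (w , u-v≡) = inj₁ (v , w) , cong (_, v) (begin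
    v + + 2 * w        ≡⟨ even v w ⟩
    v + w * + 2        ≡⟨ cong (λ d → v + d) (sym u-v≡) ⟩
    v + (u - v)        ≡⟨ restore u v ⟩
    u                  ∎)
    where
    even : ∀ v w → v + + 2 * w ≡ v + w * + 2
    even = solve-∀
    restore : ∀ u v → v + (u - v) ≡ u
    restore = solve-∀
  ... | inj₂ (w , u-v≡) = inj₂ (v , w) , cong (_, v) (begin
    v + + 2 * w + + 1  ≡⟨ odd v w ⟩
    v + (w * + 2 + + 1) ≡⟨ cong (λ d → v + d) (sym u-v≡) ⟩
    v + (u - v)        ≡⟨ restore u v ⟩
    u                  ∎)
    where
    odd : ∀ v w → v + + 2 * w + + 1 ≡ v + (w * + 2 + + 1)
    odd = solve-∀
    restore : ∀ u v → v + (u - v) ≡ u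
    restore = solve-∀

  β-residue₁ : ∀ v w → (v + + 3 * w) - + 3 * (- (+ 3 * v) - w - + 2) - + 5 ≡ (+ 5 * v + + 3 * w) * + 2 + + 1
  β-residue₁ = solve-∀

  β-residue₂ : ∀ v w → (+ 2 * v + + 3 * w + + 2) - + 3 * (w - + 2 * v - + 1) - + 5 ≡ (v * + 4) * + 2
  β-residue₂ = solve-∀

  β-injective : ∀ {s s′} → β s ≡ β s′ → s ≡ s′
  β-injective {inj₁ _} {inj₁ _} eq =
    cong inj₁ (recover (λ p → β (inj₁ p)) (λ x y → - (+ 3 * x) - y - + 6) (λ x y → x + + 3 * y + + 2) (+ 8) D₁ D₂ eq)
    where
    D₁ : ∀ v w → - (+ 3 * (- (+ 3 * v) - w - + 2)) - (v + + 3 * w) - + 6 ≡ v * + 8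
    D₁ = solve-∀
    D₂ : ∀ v w → (- (+ 3 * v) - w - + 2) + + 3 * (v + + 3 * w) + + 2 ≡ w * + 8
    D₂ = solve-∀
  β-injective {inj₂ _} {inj₂ _} eq =
    cong inj₂ (recover (λ p → β (inj₂ p)) (λ x y → y - + 3 * x - + 5) (λ x y → + 2 * x + + 2 * y - + 2) (+ 8) D₁ D₂ eq)
    where
    D₁ : ∀ v w → (+ 2 * v + + 3 * w + + 2) - + 3 * (w - + 2 * v - + 1) - + 5 ≡ v * + 8
    D₁ = solve-∀
    D₂ : ∀ v w → + 2 * (w - + 2 * v - + 1) + + 2 * (+ 2 * v + + 3 * w + + 2) - + 2 ≡ w * + 8
    D₂ = solve-∀
  β-injective {inj₁ (v , w)} {inj₂ (v′ , w′)} eq =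
    ⊥-elim (parity-separates κ (v′ * + 4 , β-residue₂ v′ w′) (+ 5 * v + + 3 * w , β-residue₁ v w) (sym eq))
    where
    κ : ℤ × ℤ → ℤ
    κ (x , y) = y - + 3 * x - + 5
  β-injective {inj₂ (v , w)} {inj₁ (v′ , w′)} eq =
    ⊥-elim (parity-separates κ (v * + 4 , β-residue₂ v w) (+ 5 * v′ + + 3 * w′ , β-residue₁ v′ w′) eq)
    where
    κ : ℤ × ℤ → ℤ
    κ (x , y) = y - + 3 * x - + 5

  β-onto : ∀ {x y} → + 8 ∣ T35 x y - + 6 → Σ Split λ s → β s ≡ (x , y)
  β-onto {x} {y} 8∣T-6 with residue-6 x y 8∣T-6
  ... | inj₁ (divides q y-3x-5≡) = inj₂ (q , x + + 2 * q + + 1) , cong₂ _,_ (first x q) (begin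
    + 2 * q + + 3 * (x + + 2 * q + + 1) + + 2  ≡⟨ second x q ⟩
    q * + 8 + + 3 * x + + 5                    ≡⟨ cong (λ e → e + + 3 * x + + 5) (sym y-3x-5≡) ⟩
    (y - + 3 * x - + 5) + + 3 * x + + 5        ≡⟨ restore x y ⟩
    y                                          ∎)
    where
    first : ∀ x q → (x + + 2 * q + + 1) - + 2 * q - + 1 ≡ x
    first = solve-∀
    second : ∀ x q → + 2 * q + + 3 * (x + + 2 * q + + 1) + + 2 ≡ q * + 8 + + 3 * x + + 5
    second = solve-∀
    restore : ∀ x y → (y - + 3 * x - + 5) + + 3 * x + + 5 ≡ y
    restore = solve-∀
  ... | inj₂ (divides q y+3x-2≡) = inj₁ (v , - x - + 3 * v - + 2) , cong₂ _,_ (first x q) (begin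
    v + + 3 * (- x - + 3 * v - + 2)            ≡⟨ second x q ⟩
    q * + 8 - + 3 * x + + 2                    ≡⟨ cong (λ e → e - + 3 * x + + 2) (sym y+3x-2≡) ⟩
    (y + + 3 * x - + 2) - + 3 * x + + 2        ≡⟨ restore x y ⟩
    y                                          ∎)
    where
    v = - q - + 1
    first : ∀ x q → - (+ 3 * (- q - + 1)) - (- x - + 3 * (- q - + 1) - + 2) - + 2 ≡ x
    first = solve-∀
    second : ∀ x q → (- q - + 1) + + 3 * (- x - + 3 * (- q - + 1) - + 2) ≡ q * + 8 - + 3 * x + + 2
    second = solve-∀
    restore : ∀ x y → (y + + 3 * x - + 2) - + 3 * x + + 2 ≡ y
    restore = solve-∀

  target≡ : ∀ n → + (2 ℕ.* (4 ℕ.* n ℕ.+ 3)) ≡ + 4 * + (2 ℕ.* n) + + 6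
  target≡ n = begin
    + (2 ℕ.* (4 ℕ.* n ℕ.+ 3))       ≡⟨ cong +_ (expand n) ⟩
    + (4 ℕ.* (2 ℕ.* n) ℕ.+ 6)       ≡⟨ ZP.pos-+ (4 ℕ.* (2 ℕ.* n)) 6 ⟩
    + (4 ℕ.* (2 ℕ.* n)) + + 6       ≡⟨ cong (_+ + 6) (ZP.pos-* 4 (2 ℕ.* n)) ⟩
    + 4 * + (2 ℕ.* n) + + 6         ∎
    where
    expand : ∀ n → 2 ℕ.* (4 ℕ.* n ℕ.+ 3) ≡ 4 ℕ.* (2 ℕ.* n) ℕ.+ 6
    expand = ℕSolver.solve-∀

  -- Both t(3,5,4b;4n+3) and t(3,5,b;n) count the descended solutions.
  part-A : ∀ b n .{{_ : NonZero b}} → t 3 5 (4 ℕ.* b) (4 ℕ.* n ℕ.+ 3) ≡ t 3 5 b n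
  part-A b n = count-unique
    (descent β Tα b N β-weight β-injective onto (count-t 3 5 (4 ℕ.* b) N))
    (count-pullback (λ p → extend (α (proj₁ p)) (proj₂ p)) (λ {p} → descended⇒sol {p})
      (λ _ _ → extend-injective α α-injective) preimage (count-t 3 5 b n))
    where
    N = 4 ℕ.* n ℕ.+ 3
    instance
      4b≢0 : NonZero (4 ℕ.* b)
      4b≢0 = ℕP.m*n≢0 4 b
    onto : ∀ {x y} → + 8 ∣ T35 x y - + (2 ℕ.* N) → Σ Split λ s → β s ≡ (x , y)
    onto {x} {y} = β-onto ∘ shift-mod8 (T35 x y) (+ (2 ℕ.* N)) (+ 6) (+ n) 2N≡6+8n
      where
      regroup : ∀ n → + 4 * (+ 2 * n) + + 6 ≡ + 6 + n * + 8
      regroup = solve-∀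
      2N≡6+8n : + (2 ℕ.* N) ≡ + 6 + + n * + 8
      2N≡6+8n = trans (target≡ n) (trans (cong (λ m → + 4 * m + + 6) (ZP.pos-* 2 n)) (regroup (+ n)))
    descended⇒sol : ∀ {p} → Descended Tα b N p → Sol 3 5 b n (extend (α (proj₁ p)) (proj₂ p))
    descended⇒sol {s , z} d = affine-injective _ _ (trans d (target≡ n))
    preimage : ∀ {p} → Sol 3 5 b n p →
      Σ (Split × ℤ) λ q → Descended Tα b N q × extend (α (proj₁ q)) (proj₂ q) ≡ p
    preimage {u , v , z} sol with α-onto u v
    ... | s , αs≡uv = (s , z) , trans (cong (λ A → + 4 * A + + 6) source) (sym (target≡ n)) ,
      cong (λ q → extend q z) αs≡uv
      where
      source : Tα s + + b * twoTri z ≡ + (2 ℕ.* n)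
      source = trans (cong (λ q → T35 (proj₁ q) (proj₂ q) + + b * twoTri z) αs≡uv) sol

open PartA using (part-A)

-- The pairs (x,y) with T35(x,y) ≡ 2 (mod 8) are γ(f,s): a choice f of
-- reflecting y, and s ∈ Split with T35 = 8·J(s) + 10, where J(s) is
-- 10a² + 12·tri(c) or 1 + 6a² + 20·tri(c).  After descent the solutions
-- are counted by the weight b·tri(z) + J(s), which is what the product of
-- series counts.
module PartB where
  open import Data.Integer using (_+_; _*_; _-_; -_)
  open import Data.Integer.Divisibility.Signed using (_∣_; divides)
  open import Data.Integer.Tactic.RingSolver using (solve-∀)
  open import Data.Sum using ([_,_]′)
  open ≡-Reasoning

  flipIf : Bool → ℤ → ℤ
  flipIf false y = y
  flipIf true y = reflect y

  flipIf-injective : ∀ f {y y′} → flipIf f y ≡ flipIf f y′ → y ≡ y′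
  flipIf-injective false eq = eq
  flipIf-injective true {y} {y′} eq =
    trans (sym (reflect-involutive y)) (trans (cong reflect eq) (reflect-involutive y′))

  -- (x , y) with x ≡ 5y + 2 (mod 8), split by the parity of (x - 5y - 2)/8.
  γ₀ : Split → ℤ × ℤ
  γ₀ (inj₁ (a , c)) = c + + 5 * a , a - + 3 * c - + 2
  γ₀ (inj₂ (a , c)) = a + + 5 * c + + 2 , c - + 3 * a

  γ : Bool × Split → ℤ × ℤ
  γ (f , s) = proj₁ (γ₀ s) , flipIf f (proj₂ (γ₀ s))

  -- The weight of a parameter, (T35(γ₀ s) - 10)/8.
  J : Split → ℕ
  J (inj₁ (a , c)) = 10 ℕ.* sq a ℕ.+ 12 ℕ.* triℤ c
  J (inj₂ (a , c)) = suc (6 ℕ.* sq a ℕ.+ 20 ℕ.* triℤ c)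

  pos-lin : ∀ p m q k → + (p ℕ.* m ℕ.+ q ℕ.* k) ≡ + p * + m + + q * + k
  pos-lin p m q k = trans (ZP.pos-+ (p ℕ.* m) (q ℕ.* k)) (cong₂ _+_ (ZP.pos-* p m) (ZP.pos-* q k))

  γ₀-weight : ∀ s → T35 (proj₁ (γ₀ s)) (proj₂ (γ₀ s)) ≡ + 8 * + J s + + 10
  γ₀-weight (inj₁ (a , c)) = begin
    T35 (c + + 5 * a) (a - + 3 * c - + 2)
      ≡⟨ identity a c ⟩
    + 8 * (+ 10 * (a * a) + + 6 * twoTri c) + + 10
      ≡⟨ cong₂ (λ A C → + 8 * (+ 10 * A + + 6 * C) + + 10) (square-sq a) (twoTri-triℤ c) ⟩
    + 8 * (+ 10 * + sq a + + 6 * (+ 2 * + triℤ c)) + + 10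
      ≡⟨ regroup (+ sq a) (+ triℤ c) ⟩
    + 8 * (+ 10 * + sq a + + 12 * + triℤ c) + + 10
      ≡⟨ cong (λ j → + 8 * j + + 10) (sym (pos-lin 10 (sq a) 12 (triℤ c))) ⟩
    + 8 * + J (inj₁ (a , c)) + + 10 ∎
    where
    identity : ∀ a c →
      + 3 * ((c + + 5 * a) * ((c + + 5 * a) + + 1)) + + 5 * ((a - + 3 * c - + 2) * ((a - + 3 * c - + 2) + + 1))
      ≡ + 8 * (+ 10 * (a * a) + + 6 * (c * (c + + 1))) + + 10
    identity = solve-∀
    regroup : ∀ A R → + 8 * (+ 10 * A + + 6 * (+ 2 * R)) + + 10 ≡ + 8 * (+ 10 * A + + 12 * R) + + 10
    regroup = solve-∀
  γ₀-weight (inj₂ (a , c)) = begin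
    T35 (a + + 5 * c + + 2) (c - + 3 * a)
      ≡⟨ identity a c ⟩
    + 8 * (+ 6 * (a * a) + + 10 * twoTri c) + + 18
      ≡⟨ cong₂ (λ A C → + 8 * (+ 6 * A + + 10 * C) + + 18) (square-sq a) (twoTri-triℤ c) ⟩
    + 8 * (+ 6 * + sq a + + 10 * (+ 2 * + triℤ c)) + + 18
      ≡⟨ regroup (+ sq a) (+ triℤ c) ⟩
    + 8 * (+ 1 + (+ 6 * + sq a + + 20 * + triℤ c)) + + 10
      ≡⟨ cong (λ j → + 8 * (+ 1 + j) + + 10) (sym (pos-lin 6 (sq a) 20 (triℤ c))) ⟩
    + 8 * (+ 1 + + (6 ℕ.* sq a ℕ.+ 20 ℕ.* triℤ c)) + + 10
      ≡⟨ cong (λ j → + 8 * j + + 10) (sym (ZP.pos-+ 1 (6 ℕ.* sq a ℕ.+ 20 ℕ.* triℤ c))) ⟩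
    + 8 * + J (inj₂ (a , c)) + + 10 ∎
    where
    identity : ∀ a c →
      + 3 * ((a + + 5 * c + + 2) * ((a + + 5 * c + + 2) + + 1)) + + 5 * ((c - + 3 * a) * ((c - + 3 * a) + + 1))
      ≡ + 8 * (+ 6 * (a * a) + + 10 * (c * (c + + 1))) + + 18
    identity = solve-∀
    regroup : ∀ A R → + 8 * (+ 6 * A + + 10 * (+ 2 * R)) + + 18 ≡ + 8 * (+ 1 + (+ 6 * A + + 20 * R)) + + 10
    regroup = solve-∀

  -- In descent form: T35(γ p) = 4·(2J + 1) + 6.
  W : Bool × Split → ℤ
  W (_ , s) = + 2 * + J s + + 1

  -- Reflecting y does not change T35.
  γ-weight : ∀ p → T35 (proj₁ (γ p)) (proj₂ (γ p)) ≡ + 4 * W p + + 6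
  γ-weight (f , s) = begin
    T35 (proj₁ (γ₀ s)) (flipIf f (proj₂ (γ₀ s)))  ≡⟨ unflip f (proj₁ (γ₀ s)) (proj₂ (γ₀ s)) ⟩
    T35 (proj₁ (γ₀ s)) (proj₂ (γ₀ s))             ≡⟨ γ₀-weight s ⟩
    + 8 * + J s + + 10                             ≡⟨ regroup (+ J s) ⟩
    + 4 * (+ 2 * + J s + + 1) + + 6                ∎
    where
    unflip : ∀ f x y → T35 x (flipIf f y) ≡ T35 x y
    unflip false x y = refl
    unflip true x y = cong (λ Y → + 3 * twoTri x + + 5 * Y) (twoTri-reflect y)
    regroup : ∀ j → + 8 * j + + 10 ≡ + 4 * (+ 2 * j + + 1) + + 6
    regroup = solve-∀

  γ₀-even : ∀ s → Even (difference (γ₀ s))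
  γ₀-even (inj₁ (a , c)) = + 2 * a + + 2 * c + + 1 , identity a c
    where
    identity : ∀ a c → (c + + 5 * a) - (a - + 3 * c - + 2) ≡ (+ 2 * a + + 2 * c + + 1) * + 2
    identity = solve-∀
  γ₀-even (inj₂ (a , c)) = + 2 * a + + 2 * c + + 1 , identity a c
    where
    identity : ∀ a c → (a + + 5 * c + + 2) - (c - + 3 * a) ≡ (+ 2 * a + + 2 * c + + 1) * + 2
    identity = solve-∀

  reflect-odd : ∀ p → Even (difference p) → Odd (difference (proj₁ p , reflect (proj₂ p)))
  reflect-odd (x , y) (w , x-y≡) = w + y , (begin
    x - reflect y            ≡⟨ expand x y ⟩
    (x - y) + y * + 2 + + 1  ≡⟨ cong (λ d → d + y * + 2 + + 1) x-y≡ ⟩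
    w * + 2 + y * + 2 + + 1  ≡⟨ collect w y ⟩
    (w + y) * + 2 + + 1      ∎)
    where
    expand : ∀ x y → x - (- y - + 1) ≡ (x - y) + y * + 2 + + 1
    expand = solve-∀
    collect : ∀ w y → w * + 2 + y * + 2 + + 1 ≡ (w + y) * + 2 + + 1
    collect = solve-∀

  γ₀-quotient₁ : ∀ a c → (c + + 5 * a) - + 5 * (a - + 3 * c - + 2) - + 2 ≡ (c * + 2 + + 1) * + 8
  γ₀-quotient₁ = solve-∀

  γ₀-quotient₂ : ∀ a c → (a + + 5 * c + + 2) - + 5 * (c - + 3 * a) - + 2 ≡ (a * + 2) * + 8
  γ₀-quotient₂ = solve-∀

  γ₀-branches : ∀ {a c a′ c′} → γ₀ (inj₁ (a , c)) ≡ γ₀ (inj₂ (a′ , c′)) → ⊥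
  γ₀-branches {a} {c} {a′} {c′} eq = even-odd-disjoint (a′ , quotients) (c , refl)
    where
    quotients : c * + 2 + + 1 ≡ a′ * + 2
    quotients = ZP.*-cancelʳ-≡ _ _ (+ 8) (trans (sym (γ₀-quotient₁ a c))
      (trans (cong (λ q → proj₁ q - + 5 * proj₂ q - + 2) eq) (γ₀-quotient₂ a′ c′)))

  γ₀-injective : ∀ {s s′} → γ₀ s ≡ γ₀ s′ → s ≡ s′
  γ₀-injective {inj₁ _} {inj₁ _} eq =
    cong inj₁ (recover (λ p → γ₀ (inj₁ p)) (λ x y → + 3 * x + y + + 2) (λ x y → x - + 5 * y - + 10) (+ 16) D₁ D₂ eq)
    where
    D₁ : ∀ a c → + 3 * (c + + 5 * a) + (a - + 3 * c - + 2) + + 2 ≡ a * + 16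
    D₁ = solve-∀
    D₂ : ∀ a c → (c + + 5 * a) - + 5 * (a - + 3 * c - + 2) - + 10 ≡ c * + 16
    D₂ = solve-∀
  γ₀-injective {inj₂ _} {inj₂ _} eq =
    cong inj₂ (recover (λ p → γ₀ (inj₂ p)) (λ x y → x - + 5 * y - + 2) (λ x y → + 3 * x + y - + 6) (+ 16) D₁ D₂ eq)
    where
    D₁ : ∀ a c → (a + + 5 * c + + 2) - + 5 * (c - + 3 * a) - + 2 ≡ a * + 16
    D₁ = solve-∀
    D₂ : ∀ a c → + 3 * (a + + 5 * c + + 2) + (c - + 3 * a) - + 6 ≡ c * + 16
    D₂ = solve-∀
  γ₀-injective {inj₁ (a , c)} {inj₂ (a′ , c′)} eq = ⊥-elim (γ₀-branches {a} {c} {a′} {c′} eq)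
  γ₀-injective {inj₂ (a , c)} {inj₁ (a′ , c′)} eq = ⊥-elim (γ₀-branches {a′} {c′} {a} {c} (sym eq))

  -- Reflected and unreflected images are separated by the parity of x - y.
  γ-injective : ∀ {p p′} → γ p ≡ γ p′ → p ≡ p′
  γ-injective {f , s} {f′ , s′} eq with f | f′
  ... | false | false = cong (false ,_) (γ₀-injective (cong₂ _,_ (cong proj₁ eq) (cong proj₂ eq)))
  ... | true | true =
    cong (true ,_) (γ₀-injective (cong₂ _,_ (cong proj₁ eq) (flipIf-injective true (cong proj₂ eq))))
  ... | false | true =
    ⊥-elim (parity-separates difference (γ₀-even s) (reflect-odd (γ₀ s′) (γ₀-even s′)) eq)
  ... | true | false =
    ⊥-elim (parity-separates difference (γ₀-even s′) (reflect-odd (γ₀ s) (γ₀-even s)) (sym eq))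

  γ₀-onto : ∀ {x y} → + 8 ∣ x - + 5 * y - + 2 → Σ Split λ s → γ₀ s ≡ (x , y)
  γ₀-onto {x} {y} (divides m x-5y-2≡) with parity m
  ... | inj₁ (h , m≡) = inj₂ (h , y + + 3 * h) , cong₂ _,_ (begin
    h + + 5 * (y + + 3 * h) + + 2   ≡⟨ first h y ⟩
    (h * + 2) * + 8 + + 5 * y + + 2 ≡⟨ cong (λ k → k * + 8 + + 5 * y + + 2) (sym m≡) ⟩
    m * + 8 + + 5 * y + + 2         ≡⟨ sym x≡ ⟩
    x                               ∎) (second h y)
    where
    first : ∀ h y → h + + 5 * (y + + 3 * h) + + 2 ≡ (h * + 2) * + 8 + + 5 * y + + 2
    first = solve-∀
    second : ∀ h y → (y + + 3 * h) - + 3 * h ≡ y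
    second = solve-∀
    x≡ : x ≡ m * + 8 + + 5 * y + + 2
    x≡ = trans (restore x y) (cong (λ k → k + + 5 * y + + 2) x-5y-2≡)
      where
      restore : ∀ x y → x ≡ (x - + 5 * y - + 2) + + 5 * y + + 2
      restore = solve-∀
  ... | inj₂ (h , m≡) = inj₁ (y + + 3 * h + + 2 , h) , cong₂ _,_ (begin
    h + + 5 * (y + + 3 * h + + 2)         ≡⟨ first h y ⟩
    (h * + 2 + + 1) * + 8 + + 5 * y + + 2 ≡⟨ cong (λ k → k * + 8 + + 5 * y + + 2) (sym m≡) ⟩
    m * + 8 + + 5 * y + + 2               ≡⟨ sym x≡ ⟩
    x                                     ∎) (second h y)
    where
    first : ∀ h y → h + + 5 * (y + + 3 * h + + 2) ≡ (h * + 2 + + 1) * + 8 + + 5 * y + + 2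
    first = solve-∀
    second : ∀ h y → (y + + 3 * h + + 2) - + 3 * h - + 2 ≡ y
    second = solve-∀
    x≡ : x ≡ m * + 8 + + 5 * y + + 2
    x≡ = trans (restore x y) (cong (λ k → k + + 5 * y + + 2) x-5y-2≡)
      where
      restore : ∀ x y → x ≡ (x - + 5 * y - + 2) + + 5 * y + + 2
      restore = solve-∀

  -- By residue-2, every pair with T35 ≡ 2 (mod 8) is γ(p); the second
  -- residue class is the first one after reflecting y.
  γ-onto : ∀ {x y} → + 8 ∣ T35 x y - + 2 → Σ (Bool × Split) λ p → γ p ≡ (x , y)
  γ-onto {x} {y} 8∣T-2 with residue-2 x y 8∣T-2
  ... | inj₁ 8∣x-5y-2 with γ₀-onto 8∣x-5y-2
  ...   | s , γ₀s≡ = (false , s) , γ₀s≡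
  γ-onto {x} {y} 8∣T-2 | inj₂ 8∣x+5y+3
    with γ₀-onto {x} {reflect y} (subst (+ 8 ∣_) (sym (reflected x y)) 8∣x+5y+3)
    where
    reflected : ∀ x y → x - + 5 * (- y - + 1) - + 2 ≡ x + + 5 * y + + 3
    reflected = solve-∀
  ...   | s , γ₀s≡ = (true , s) ,
    cong₂ _,_ (cong proj₁ γ₀s≡) (trans (cong reflect (cong proj₂ γ₀s≡)) (reflect-involutive y))

  descended⇔ : ∀ b n f s z →
    (Descended W b (4 ℕ.* n ℕ.+ 5) ((f , s) , z) → b ℕ.* triℤ z ℕ.+ J s ≡ n) ×
    (b ℕ.* triℤ z ℕ.+ J s ≡ n → Descended W b (4 ℕ.* n ℕ.+ 5) ((f , s) , z))
  descended⇔ b n f s z =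
    (λ d → ℕP.*-cancelˡ-≡ X n 8
      (ℕP.+-cancelˡ-≡ 10 _ _ (trans (ZP.+-injective (trans (sym lhs≡) d)) (expand n)))) ,
    (λ X≡n → trans lhs≡ (cong +_ (trans (cong (λ m → 10 ℕ.+ 8 ℕ.* m) X≡n) (sym (expand n)))))
    where
    X = b ℕ.* triℤ z ℕ.+ J s
    expand : ∀ n → 2 ℕ.* (4 ℕ.* n ℕ.+ 5) ≡ 10 ℕ.+ 8 ℕ.* n
    expand = ℕSolver.solve-∀
    regroup : ∀ B T J → + 4 * (+ 2 * J + + 1 + B * (+ 2 * T)) + + 6 ≡ + 10 + + 8 * (B * T + J)
    regroup = solve-∀
    cast : + X ≡ + b * + triℤ z + + J s
    cast = trans (ZP.pos-+ (b ℕ.* triℤ z) (J s)) (cong (_+ + J s) (ZP.pos-* b (triℤ z)))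
    lhs≡ : + 4 * (W (f , s) + + b * twoTri z) + + 6 ≡ + (10 ℕ.+ 8 ℕ.* X)
    lhs≡ = begin
      + 4 * (+ 2 * + J s + + 1 + + b * twoTri z) + + 6
        ≡⟨ cong (λ Z → + 4 * (+ 2 * + J s + + 1 + + b * Z) + + 6) (twoTri-triℤ z) ⟩
      + 4 * (+ 2 * + J s + + 1 + + b * (+ 2 * + triℤ z)) + + 6
        ≡⟨ regroup (+ b) (+ triℤ z) (+ J s) ⟩
      + 10 + + 8 * (+ b * + triℤ z + + J s)
        ≡⟨ cong (λ Y → + 10 + + 8 * Y) (sym cast) ⟩
      + 10 + + 8 * + X
        ≡⟨ cong (λ Y → + 10 + Y) (sym (ZP.pos-* 8 X)) ⟩
      + 10 + + (8 ℕ.* X)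
        ≡⟨ sym (ZP.pos-+ 10 (8 ℕ.* X)) ⟩
      + (10 ℕ.+ 8 ℕ.* X) ∎

  Terms : Set
  Terms = (ℤ × ℕ) ⊎ (ℤ × ℕ)

  J₁ J₂ : ℤ × ℕ → ℕ
  J₁ (a , j) = 10 ℕ.* sq a ℕ.+ 12 ℕ.* tri j
  J₂ (a , j) = suc (6 ℕ.* sq a ℕ.+ 20 ℕ.* tri j)

  -- (sign of z, reflection flag, sign of c, fold z, term).
  Index : Set
  Index = Bool × Bool × Bool × ℕ × Terms

  weight : ℕ → Index → ℕ
  weight b (_ , _ , _ , k , τ) = b ℕ.* tri k ℕ.+ [ J₁ , J₂ ]′ τ

  RHS : ℕ → Series
  RHS b = dil b ψ ⊛ ((dil 10 φ ⊛ dil 12 ψ) ⊕ qTimes (dil 6 φ ⊛ dil 20 ψ))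

  rhs-fib : ∀ b .{{_ : NonZero b}} → Fib (weight b) (2 · (2 · (2 · RHS b)))
  rhs-fib b = double-fib (double-fib (double-fib (conv-fib (dil-fib b ψ-fib)
    (⊕-fib (conv-fib (dil-fib 10 φ-fib) (dil-fib 12 ψ-fib))
           (qTimes-fib (conv-fib (dil-fib 6 φ-fib) (dil-fib 20 ψ-fib)))))))

  attach : Bool → Terms → Split
  attach sc (inj₁ (a , j)) = inj₁ (a , signed sc j)
  attach sc (inj₂ (a , j)) = inj₂ (a , signed sc j)

  detach : Split → Bool × Terms
  detach (inj₁ (a , c)) = proj₁ (sign-split c) , inj₁ (a , proj₂ (sign-split c))
  detach (inj₂ (a , c)) = proj₁ (sign-split c) , inj₂ (a , proj₂ (sign-split c))

  detach-attach : ∀ sc τ → detach (attach sc τ) ≡ (sc , τ)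
  detach-attach sc (inj₁ (a , j)) = cong (λ p → proj₁ p , inj₁ (a , proj₂ p)) (split-signed sc j)
  detach-attach sc (inj₂ (a , j)) = cong (λ p → proj₁ p , inj₂ (a , proj₂ p)) (split-signed sc j)

  attach-detach : ∀ s → attach (proj₁ (detach s)) (proj₂ (detach s)) ≡ s
  attach-detach (inj₁ (a , c)) = cong (λ c → inj₁ (a , c)) (signed-split c)
  attach-detach (inj₂ (a , c)) = cong (λ c → inj₂ (a , c)) (signed-split c)

  J-attach : ∀ sc τ → J (attach sc τ) ≡ [ J₁ , J₂ ]′ τ
  J-attach sc (inj₁ (a , j)) = cong (λ k → 10 ℕ.* sq a ℕ.+ 12 ℕ.* tri k) (fold-signed sc j)
  J-attach sc (inj₂ (a , j)) = cong (λ k → suc (6 ℕ.* sq a ℕ.+ 20 ℕ.* tri k)) (fold-signed sc j)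

  χ : Index → (Bool × Split) × ℤ
  χ (sz , f , sc , k , τ) = (f , attach sc τ) , signed sz k

  χ⁻¹ : (Bool × Split) × ℤ → Index
  χ⁻¹ ((f , s) , z) =
    proj₁ (sign-split z) , f , proj₁ (detach s) , proj₂ (sign-split z) , proj₂ (detach s)

  χ⁻¹-χ : ∀ e → χ⁻¹ (χ e) ≡ e
  χ⁻¹-χ (sz , f , sc , k , τ) =
    cong₂ (λ p q → proj₁ p , f , proj₁ q , proj₂ p , proj₂ q) (split-signed sz k) (detach-attach sc τ)

  χ-χ⁻¹ : ∀ q → χ (χ⁻¹ q) ≡ q
  χ-χ⁻¹ ((f , s) , z) = cong₂ (λ s z → (f , s) , z) (attach-detach s) (signed-split z)

  weight-χ : ∀ b e → b ℕ.* triℤ (proj₂ (χ e)) ℕ.+ J (proj₂ (proj₁ (χ e))) ≡ weight b e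
  weight-χ b (sz , f , sc , k , τ) =
    cong₂ (λ k J → b ℕ.* tri k ℕ.+ J) (fold-signed sz k) (J-attach sc τ)

  target≡ : ∀ n → + (2 ℕ.* (4 ℕ.* n ℕ.+ 5)) ≡ + 2 + (+ n + + 1) * + 8
  target≡ n = begin
    + (2 ℕ.* (4 ℕ.* n ℕ.+ 5))       ≡⟨ cong +_ (expand n) ⟩
    + (2 ℕ.+ n ℕ.* 8 ℕ.+ 8)         ≡⟨ pos-lin′ ⟩
    + 2 + + n * + 8 + + 8           ≡⟨ regroup (+ n) ⟩
    + 2 + (+ n + + 1) * + 8         ∎
    where
    expand : ∀ n → 2 ℕ.* (4 ℕ.* n ℕ.+ 5) ≡ 2 ℕ.+ n ℕ.* 8 ℕ.+ 8
    expand = ℕSolver.solve-∀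
    pos-lin′ : + (2 ℕ.+ n ℕ.* 8 ℕ.+ 8) ≡ + 2 + + n * + 8 + + 8
    pos-lin′ = trans (ZP.pos-+ (2 ℕ.+ n ℕ.* 8) 8)
      (cong (_+ + 8) (trans (ZP.pos-+ 2 (n ℕ.* 8)) (cong (λ Y → + 2 + Y) (ZP.pos-* n 8))))
    regroup : ∀ n → + 2 + n * + 8 + + 8 ≡ + 2 + (n + + 1) * + 8
    regroup = solve-∀

  -- The series count the descended solutions of t(3,5,4b;4n+5).
  part-B : ∀ b n .{{_ : NonZero b}} → t 3 5 (4 ℕ.* b) (4 ℕ.* n ℕ.+ 5) ≡ (8 · RHS b) n
  part-B b n = trans (count-unique solutions (rhs-fib b n)) (eight (RHS b n))
    where
    N = 4 ℕ.* n ℕ.+ 5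
    instance
      4b≢0 : NonZero (4 ℕ.* b)
      4b≢0 = ℕP.m*n≢0 4 b
    onto : ∀ {x y} → + 8 ∣ T35 x y - + (2 ℕ.* N) → Σ (Bool × Split) λ p → γ p ≡ (x , y)
    onto {x} {y} = γ-onto ∘ shift-mod8 (T35 x y) (+ (2 ℕ.* N)) (+ 2) (+ n + + 1) (target≡ n)
    solutions : Count (λ e → weight b e ≡ n) (t 3 5 (4 ℕ.* b) N)
    solutions = count-pullback χ (λ {e} → weighted⇒descended {e})
      (λ {e} {e′} _ _ eq → trans (sym (χ⁻¹-χ e)) (trans (cong χ⁻¹ eq) (χ⁻¹-χ e′)))
      (λ {q} → descended⇒weighted {q})
      (descent γ W b N γ-weight γ-injective onto (count-t 3 5 (4 ℕ.* b) N))
      where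
      weighted⇒descended : ∀ {e} → weight b e ≡ n → Descended W b N (χ e)
      weighted⇒descended {e@(_ , f , sc , _ , τ)} w≡n =
        proj₂ (descended⇔ b n f (attach sc τ) (proj₂ (χ e))) (trans (weight-χ b e) w≡n)
      descended⇒weighted : ∀ {q} → Descended W b N q → Σ Index λ e → weight b e ≡ n × χ e ≡ q
      descended⇒weighted {q@((f , s) , z)} d = χ⁻¹ q , (begin
        weight b (χ⁻¹ q)                                           ≡⟨ sym (weight-χ b (χ⁻¹ q)) ⟩
        b ℕ.* triℤ (proj₂ (χ (χ⁻¹ q))) ℕ.+ J (proj₂ (proj₁ (χ (χ⁻¹ q))))
          ≡⟨ cong (λ q → b ℕ.* triℤ (proj₂ q) ℕ.+ J (proj₂ (proj₁ q))) (χ-χ⁻¹ q) ⟩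
        b ℕ.* triℤ z ℕ.+ J s                                      ≡⟨ proj₁ (descended⇔ b n f s z) d ⟩
        n                                                          ∎) , χ-χ⁻¹ q
    eight : ∀ X → 2 ℕ.* (2 ℕ.* (2 ℕ.* X)) ≡ 8 ℕ.* X
    eight = ℕSolver.solve-∀

open PartB using (part-B)

open import Data.Nat using (_+_; _*_)

lemma6p3 : (b : ℕ) → 1 ≤ b →
    ((n : ℕ) → 1 ≤ n → t 3 5 (4 * b) (4 * n + 3) ≡ t 3 5 b n)
    × ((n : ℕ) → t 3 5 (4 * b) (4 * n + 5)
    ≡ (8 · (dil b ψ ⊛ ((dil 10 φ ⊛ dil 12 ψ) ⊕ qTimes (dil 6 φ ⊛ dil 20 ψ)))) n)
lemma6p3 zero ()
lemma6p3 b@(suc _) _ = (λ n _ → part-A b n) , (λ n → part-B b n)
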